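{- For every $k,\ell\ge1$, the map $$\omega(\tau)=1\,0^{\tau_1-\tau_2-1}\,1\,0^{\tau_2-\tau_3-1}\cdots 1\,0^{\tau_{k-1}-\tau_k-1}\,1\,0^{\tau_k-1}$$ is a bijection from the set of wide triangular partitions $\tau=\tau_1\dots\tau_k$ with exactly $k$ parts and $\tau_1=\ell$ to the set of balanced binary words $w=w_1\dots w_\ell$ of length $\ell$ having exactly $k$ ones and $w_1=1$.
   Context: $\mathbb{N}$ denotes the positive integers. A partition $\tau=\tau_1\dots\tau_k$ is identified with its Ferrers diagram $\{(a,b)\in\mathbb{N}^2:1\le b\le k,\,1\le a\le\tau_b\}$. For $r,s>0$, $\mathsf{L}_{r,s}$ is the line $x/r+y/s=1$; it is a cutting line for $\tau$ if $\tau$ is exactly the set of points of $\mathbb{N}^2$ on or below it; $\tau$ is triangular if it has a cutting line, and wide if it has a cutting line $\mathsf{L}_{r,s}$ with $r>s$ (wide triangular partitions have distinct parts, so the exponents above are nonnegative). A finite binary word $w=w_1\dots w_\ell$ is balanced if for all $h\le\ell$ and all $i,j\le \ell-h+1$, $\left|\sum_{t=i}^{i+h-1}w_t-\sum_{t=j}^{j+h-1}w_t\right|\le1$. $0^m$ denotes $m$ consecutive zeros.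
   Formalization: The parameters r and s of the cutting line $\mathsf{L}_{r,s}$ with $r>s$ that makes a partition wide are rational. -}

module Defs where

open import Data.Nat as ℕ using (ℕ; zero; suc; _∸_)
open import Data.Integer using (+_)
open import Data.Rational as ℚ using (ℚ; _/_; 0ℚ)
open import Data.Bool using (Bool; true; false)
open import Data.List using (List; []; _∷_; length; replicate; _++_; take; drop)
open import Data.Product using (Σ; _×_; ∃-syntax)
open import Relation.Binary.PropositionalEquality using (_≡_)
open import Function.Bundles using (_⇔_)

data Nonincreasing : List ℕ → Set where
  ni-[]  : Nonincreasing []
  ni-[x] : ∀ {x} → Nonincreasing (x ∷ [])
  ni-∷   : ∀ {x y ys} → y ℕ.≤ x → Nonincreasing (y ∷ ys) → Nonincreasing (x ∷ y ∷ ys)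

data AllPositive : List ℕ → Set where
  ap-[] : AllPositive []
  ap-∷  : ∀ {x xs} → 1 ℕ.≤ x → AllPositive xs → AllPositive (x ∷ xs)

IsPartition : List ℕ → Set
IsPartition τ = Nonincreasing τ × AllPositive τ

-- b-th part τ_b (1-indexed); 0 if b = 0 or b > k.
part : List ℕ → ℕ → ℕ
part []       _             = 0
part (x ∷ _)  1             = x
part (_ ∷ xs) (suc (suc b)) = part xs (suc b)
part (_ ∷ _)  zero          = 0

InDiagram : List ℕ → ℕ → ℕ → Set
InDiagram τ a b = (1 ℕ.≤ b) × (b ℕ.≤ length τ) × (1 ℕ.≤ a) × (a ℕ.≤ part τ b)

toℚ : ℕ → ℚ
toℚ n = + n / 1

-- L_{r,s} (r,s > 0) is a cutting line of τ: for all (a,b) ∈ ℕ² (positive integers),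
-- (a,b) ∈ τ iff a/r + b/s ≤ 1, written equivalently (multiplying by r·s > 0)
-- as a·s + b·r ≤ r·s.
CuttingLine : ℚ → ℚ → List ℕ → Set
CuttingLine r s τ =
  ∀ (a b : ℕ) → 1 ℕ.≤ a → 1 ℕ.≤ b →
    InDiagram τ a b ⇔ ((toℚ a ℚ.* s ℚ.+ toℚ b ℚ.* r) ℚ.≤ r ℚ.* s)

Wide : List ℕ → Set
Wide τ = ∃[ r ] ∃[ s ] ((0ℚ ℚ.< s) × (s ℚ.< r) × CuttingLine r s τ)

firstPart : List ℕ → ℕ
firstPart []      = 0
firstPart (x ∷ _) = x

WideTriangular : ℕ → ℕ → List ℕ → Set
WideTriangular k ℓ τ = IsPartition τ × Wide τ × (length τ ≡ k) × (firstPart τ ≡ ℓ)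

bit : Bool → ℕ
bit true  = 1
bit false = 0

ones : List Bool → ℕ
ones []       = 0
ones (x ∷ xs) = bit x ℕ.+ ones xs

Close : ℕ → ℕ → Set
Close m n = (m ℕ.≤ suc n) × (n ℕ.≤ suc m)

-- factor of length h starting at 0-indexed position i
window : ℕ → ℕ → List Bool → List Bool
window i h w = take h (drop i w)

Balanced : List Bool → Set
Balanced w = ∀ (h i j : ℕ) → h ℕ.≤ length w → i ℕ.+ h ℕ.≤ length w → j ℕ.+ h ℕ.≤ length w →
  Close (ones (window i h w)) (ones (window j h w))

firstBit : List Bool → Bool
firstBit []      = false
firstBit (x ∷ _) = x

BalancedWord : ℕ → ℕ → List Bool → Set
BalancedWord k ℓ w = (length w ≡ ℓ) × Balanced w × (ones w ≡ k) × (firstBit w ≡ true)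

ω : List ℕ → List Bool
ω []            = []
ω (t ∷ [])      = true ∷ replicate (t ∸ 1) false
ω (t ∷ u ∷ ts)  = true ∷ (replicate (t ∸ u ∸ 1) false ++ ω (u ∷ ts))

{-# OPTIONS --safe #-}
module Submission where

-- The 1s of ω τ sit at the positions ℓ − τ_b (counting from 0), so τ is read back from the word
-- as ω⁻¹, and the cell (a+1, b+1) lies in τ exactly when the prefix of length ℓ − a contains at
-- least b+1 ones. Clearing denominators, a cutting line with r > s is a triple of naturals A < B, C
-- whose cells are those with (a+1)A + (b+1)B ≤ C. Together: τ is wide triangular iff ω τ is
-- mechanical, i.e. for n + m = ℓ the prefix of length n has ⌊(C − (m+1)A)/B⌋ ones. Then every
-- factor u has |ones u − |u|·A/B| < 1, which makes the word balanced. Conversely, in a balanced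
-- word (ones u − 1)/|u| < (ones v + 1)/|v| for all factors u, v (cut the longer factor at the
-- length of the shorter, as in Euclid's algorithm); a fraction A/B strictly between these two
-- families exists, and C is the largest of the values (m+1)A + B·(ones in the prefix of length n).

open import Defs
open import Data.Bool using (Bool; true; false)
open import Data.Integer as ℤ using (+[1+_]; -[1+_]; +≤+; +<+)
import Data.Integer.Properties as ℤ
open import Data.List
  using (List; []; _∷_; length; replicate; _++_; take; drop; map; applyUpTo; upTo; filter; cartesianProduct)
import Data.List.Properties as List
open import Data.List.Extrema.Nat using (max; xs≤max; max<v⁺; argmax-all)
open import Data.List.Membership.Propositional using (_∈_)
open import Data.List.Membership.Propositional.Properties
  using (∈-applyUpTo⁺; ∈-map⁺; ∈-upTo⁺; ∈-filter⁺; ∈-cartesianProduct⁺)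
open import Data.List.Relation.Unary.All using (All)
import Data.List.Relation.Unary.All as All
import Data.List.Relation.Unary.All.Properties as All
open import Data.List.Relation.Unary.Linked using (Linked; []; [-]; _∷_)
open import Data.Nat
  using (ℕ; zero; suc; _+_; _*_; _∸_; _/_; _%_; _≤_; _<_; _>_; z≤n; s≤s; s≤s⁻¹; _≤?_; NonZero;
         compare; less; equal; greater)
open import Data.Nat.DivMod using (m≡m%n+[m/n]*n; m%n<n; m/n*n≤m)
open import Data.Nat.Induction using (<-wellFounded)
open import Data.Nat.Properties
open import Data.Nat.Tactic.RingSolver using (solve-∀)
open import Data.Product using (_×_; _,_; proj₁; proj₂; ∃-syntax)
open import Data.Rational as ℚ using (mkℚ; 0ℚ; toℚᵘ; fromℚᵘ)
import Data.Rational.Properties as ℚ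
open import Data.Rational.Unnormalised as ℚᵘ using (ℚᵘ; mkℚᵘ; ↥_; ↧ₙ_; *≤*; *<*; _≃_)
import Data.Rational.Unnormalised.Properties as ℚᵘ
open import Data.Sum using (inj₁; inj₂)
open import Function using (_∘_)
open import Function.Bundles using (_⇔_; mk⇔; Equivalence)
open import Function.Properties.Equivalence using () renaming (trans to ⇔-trans; sym to ⇔-sym)
open import Induction.WellFounded using (Acc; acc)
open import Relation.Binary.PropositionalEquality
open import Relation.Nullary using (yes; no; contradiction)
open import Relation.Unary using (Decidable)

open Equivalence using (to; from)

prefixOnes : List Bool → ℕ → ℕ
prefixOnes w n = ones (take n w)

factorOnes : List Bool → ℕ → ℕ → ℕ
factorOnes w i h = ones (window i h w)

ones-take-+ : ∀ h h′ v → ones (take (h + h′) v) ≡ ones (take h v) + ones (take h′ (drop h v))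
ones-take-+ zero    h′ v       = refl
ones-take-+ (suc h) h′ []      = cong ones (sym (List.take-[] h′))
ones-take-+ (suc h) h′ (x ∷ v) = trans (cong (bit x +_) (ones-take-+ h h′ v)) (sym (+-assoc (bit x) _ _))

ones-take-≤ : ∀ h v → ones (take h v) ≤ h
ones-take-≤ zero    v           = z≤n
ones-take-≤ (suc h) []          = z≤n
ones-take-≤ (suc h) (true ∷ v)  = s≤s (ones-take-≤ h v)
ones-take-≤ (suc h) (false ∷ v) = m≤n⇒m≤1+n (ones-take-≤ h v)

factorOnes-+ : ∀ w i h h′ → factorOnes w i (h + h′) ≡ factorOnes w i h + factorOnes w (i + h) h′
factorOnes-+ w i h h′ = begin
  ones (take (h + h′) (drop i w))                         ≡⟨ ones-take-+ h h′ (drop i w) ⟩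
  factorOnes w i h + ones (take h′ (drop h (drop i w)))   ≡⟨ cong (λ v → factorOnes w i h + ones (take h′ v))
                                                                  (List.drop-drop i h w) ⟩
  factorOnes w i h + factorOnes w (i + h) h′              ∎
  where open ≡-Reasoning

prefixOnes-+ : ∀ w n h → prefixOnes w (n + h) ≡ prefixOnes w n + factorOnes w n h
prefixOnes-+ w = factorOnes-+ w 0

factorOnes-≤ : ∀ w i h → factorOnes w i h ≤ h
factorOnes-≤ w i h = ones-take-≤ h (drop i w)

prefixOnes-[] : ∀ n → prefixOnes [] n ≡ 0
prefixOnes-[] n = cong ones (List.take-[] n)

ω⁻¹ : List Bool → List ℕ
ω⁻¹ []          = []
ω⁻¹ (true ∷ w)  = suc (length w) ∷ ω⁻¹ w
ω⁻¹ (false ∷ w) = ω⁻¹ w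

length-ω⁻¹ : ∀ w → length (ω⁻¹ w) ≡ ones w
length-ω⁻¹ []          = refl
length-ω⁻¹ (true ∷ w)  = cong suc (length-ω⁻¹ w)
length-ω⁻¹ (false ∷ w) = length-ω⁻¹ w

nonincreasing-∷-ω⁻¹ : ∀ n w → length w ≤ n → Nonincreasing (n ∷ ω⁻¹ w)
nonincreasing-∷-ω⁻¹ n []          _   = ni-[x]
nonincreasing-∷-ω⁻¹ n (true ∷ w)  ℓ≤n = ni-∷ ℓ≤n (nonincreasing-∷-ω⁻¹ _ w (n≤1+n _))
nonincreasing-∷-ω⁻¹ n (false ∷ w) ℓ≤n = nonincreasing-∷-ω⁻¹ n w (m+n≤o⇒n≤o 1 ℓ≤n)

ω⁻¹-nonincreasing : ∀ w → Nonincreasing (ω⁻¹ w)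
ω⁻¹-nonincreasing []          = ni-[]
ω⁻¹-nonincreasing (true ∷ w)  = nonincreasing-∷-ω⁻¹ _ w (n≤1+n _)
ω⁻¹-nonincreasing (false ∷ w) = ω⁻¹-nonincreasing w

ω⁻¹-allPositive : ∀ w → AllPositive (ω⁻¹ w)
ω⁻¹-allPositive []          = ap-[]
ω⁻¹-allPositive (true ∷ w)  = ap-∷ (s≤s z≤n) (ω⁻¹-allPositive w)
ω⁻¹-allPositive (false ∷ w) = ω⁻¹-allPositive w

ω⁻¹-isPartition : ∀ w → IsPartition (ω⁻¹ w)
ω⁻¹-isPartition w = ω⁻¹-nonincreasing w , ω⁻¹-allPositive w

ω⁻¹-0ⁿ : ∀ n → ω⁻¹ (replicate n false) ≡ []
ω⁻¹-0ⁿ zero    = refl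
ω⁻¹-0ⁿ (suc n) = ω⁻¹-0ⁿ n

ω⁻¹-0ⁿ++ : ∀ n w → ω⁻¹ (replicate n false ++ w) ≡ ω⁻¹ w
ω⁻¹-0ⁿ++ zero    w = refl
ω⁻¹-0ⁿ++ (suc n) w = ω⁻¹-0ⁿ++ n w

0ⁿ++0∷ : ∀ n w → replicate n false ++ false ∷ w ≡ false ∷ replicate n false ++ w
0ⁿ++0∷ zero    w = refl
0ⁿ++0∷ (suc n) w = cong (false ∷_) (0ⁿ++0∷ n w)

ω-∷-ω⁻¹ : ∀ j w → ω (suc (j + length w) ∷ ω⁻¹ w) ≡ true ∷ replicate j false ++ w
ω-∷-ω⁻¹ j [] = begin
  true ∷ replicate (j + 0) false  ≡⟨ cong (λ k → true ∷ replicate k false) (+-identityʳ j) ⟩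
  true ∷ replicate j false        ≡⟨ cong (true ∷_) (List.++-identityʳ _) ⟨
  true ∷ replicate j false ++ []  ∎
  where open ≡-Reasoning
ω-∷-ω⁻¹ j (true ∷ w) = begin
  true ∷ replicate (suc j + suc ℓ ∸ suc ℓ ∸ 1) false ++ ω (suc ℓ ∷ ω⁻¹ w)
    ≡⟨ cong (λ k → true ∷ replicate (k ∸ 1) false ++ ω (suc ℓ ∷ ω⁻¹ w)) (m+n∸n≡m (suc j) (suc ℓ)) ⟩
  true ∷ replicate j false ++ ω (suc ℓ ∷ ω⁻¹ w)
    ≡⟨ cong (λ v → true ∷ replicate j false ++ v) (ω-∷-ω⁻¹ 0 w) ⟩
  true ∷ replicate j false ++ true ∷ w  ∎
  where
  open ≡-Reasoning
  ℓ : ℕ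
  ℓ = length w
ω-∷-ω⁻¹ j (false ∷ w) = begin
  ω (suc (j + suc (length w)) ∷ ω⁻¹ w)   ≡⟨ cong (λ k → ω (suc k ∷ ω⁻¹ w)) (+-suc j (length w)) ⟩
  ω (suc (suc j + length w) ∷ ω⁻¹ w)     ≡⟨ ω-∷-ω⁻¹ (suc j) w ⟩
  true ∷ false ∷ replicate j false ++ w  ≡⟨ cong (true ∷_) (0ⁿ++0∷ j w) ⟨
  true ∷ replicate j false ++ false ∷ w  ∎
  where open ≡-Reasoning

ω-ω⁻¹ : ∀ w → ω (ω⁻¹ (true ∷ w)) ≡ true ∷ w
ω-ω⁻¹ = ω-∷-ω⁻¹ 0

length-ω : ∀ {τ} → Linked _>_ τ → AllPositive τ → length (ω τ) ≡ firstPart τ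
length-ω []                     _                      = refl
length-ω {suc t ∷ []} [-]       (ap-∷ (s≤s z≤n) _)     = cong suc (List.length-replicate t)
length-ω {t ∷ u ∷ τ} (u<t ∷ dec) (ap-∷ _ pos) = begin
  suc (length (replicate (t ∸ u ∸ 1) false ++ ω (u ∷ τ)))
    ≡⟨ cong suc (List.length-++ (replicate (t ∸ u ∸ 1) false)) ⟩
  suc (length (replicate (t ∸ u ∸ 1) false) + length (ω (u ∷ τ)))
    ≡⟨ cong₂ (λ m n → suc (m + n)) (List.length-replicate (t ∸ u ∸ 1)) (length-ω dec pos) ⟩
  suc (t ∸ u ∸ 1 + u)
    ≡⟨ cong (λ m → suc (m + u)) (trans (∸-+-assoc t u 1) (cong (t ∸_) (+-comm u 1))) ⟩
  suc (t ∸ suc u + u)  ≡⟨ +-suc (t ∸ suc u) u ⟨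
  t ∸ suc u + suc u    ≡⟨ m∸n+n≡m u<t ⟩
  t                    ∎
  where open ≡-Reasoning

ω⁻¹-ω : ∀ {τ} → Linked _>_ τ → AllPositive τ → ω⁻¹ (ω τ) ≡ τ
ω⁻¹-ω []                      _                  = refl
ω⁻¹-ω {suc t ∷ []} [-]        (ap-∷ (s≤s z≤n) _) =
  cong₂ (λ n τ → suc n ∷ τ) (List.length-replicate t) (ω⁻¹-0ⁿ t)
ω⁻¹-ω {t ∷ u ∷ τ} (u<t ∷ dec) pos@(ap-∷ _ tail) =
  cong₂ _∷_ (length-ω (u<t ∷ dec) pos) (trans (ω⁻¹-0ⁿ++ (t ∸ u ∸ 1) (ω (u ∷ τ))) (ω⁻¹-ω dec tail))

part-length : ∀ τ b → 1 ≤ part τ (suc b) → suc b ≤ length τ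
part-length (x ∷ τ) zero    _   = s≤s z≤n
part-length (x ∷ τ) (suc b) τ>0 = s≤s (part-length τ b τ>0)

inDiagram⇔ : ∀ τ a b → InDiagram τ (suc a) (suc b) ⇔ suc a ≤ part τ (suc b)
inDiagram⇔ τ a b = mk⇔ (λ (_ , _ , _ , a<τ) → a<τ)
  (λ a<τ → s≤s z≤n , part-length τ b (≤-trans (s≤s z≤n) a<τ) , s≤s z≤n , a<τ)

-- Cells are indexed from 0 here: Φ a b decides the cell (a+1, b+1).
CutOutBy : List ℕ → (ℕ → ℕ → Set) → Set
CutOutBy τ Φ = ∀ a b → suc a ≤ part τ (suc b) ⇔ Φ a b

cutOut-decreasing : ∀ {τ Φ} → (∀ a b → Φ a (suc b) → Φ (suc a) b) →
                    CutOutBy τ Φ → AllPositive τ → Linked _>_ τ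
cutOut-decreasing trade cut ap-[]          = []
cutOut-decreasing trade cut (ap-∷ _ ap-[]) = [-]
cutOut-decreasing {x ∷ suc y ∷ τ} trade cut (ap-∷ _ pos@(ap-∷ (s≤s z≤n) _)) =
  from (cut (suc y) 0) (trade y 0 (to (cut y 1) ≤-refl))
  ∷ cutOut-decreasing (λ a b → trade a (suc b)) (λ a b → cut a (suc b)) pos

part-ω⁻¹-≤ : ∀ w b → part (ω⁻¹ w) b ≤ length w
part-ω⁻¹-≤ []          b             = z≤n
part-ω⁻¹-≤ (false ∷ w) b             = m≤n⇒m≤1+n (part-ω⁻¹-≤ w b)
part-ω⁻¹-≤ (true ∷ w)  zero          = z≤n
part-ω⁻¹-≤ (true ∷ w)  (suc zero)    = ≤-refl
part-ω⁻¹-≤ (true ∷ w)  (suc (suc b)) = m≤n⇒m≤1+n (part-ω⁻¹-≤ w (suc b))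

ω⁻¹-cutOut : ∀ w → CutOutBy (ω⁻¹ w) (λ a b → suc b ≤ prefixOnes w (length w ∸ a))
ω⁻¹-cutOut [] a b =
  mk⇔ (λ ()) (λ b<P → contradiction (subst (suc b ≤_) (prefixOnes-[] (0 ∸ a)) b<P) λ ())
ω⁻¹-cutOut (x ∷ w) a b with a ≤? length w
... | no a≰ℓ rewrite m≤n⇒m∸n≡0 (≰⇒> a≰ℓ) =
  mk⇔ (λ a<τ → contradiction (s≤s⁻¹ (≤-trans a<τ (part-ω⁻¹-≤ (x ∷ w) (suc b)))) a≰ℓ) (λ ())
... | yes a≤ℓ rewrite +-∸-assoc 1 a≤ℓ = next x b
  where
  next : ∀ x b → suc a ≤ part (ω⁻¹ (x ∷ w)) (suc b) ⇔ suc b ≤ bit x + prefixOnes w (length w ∸ a)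
  next false b       = ω⁻¹-cutOut w a b
  next true  zero    = mk⇔ (λ _ → s≤s z≤n) (λ _ → s≤s a≤ℓ)
  next true  (suc b) = mk⇔ (s≤s ∘ to (ω⁻¹-cutOut w a b)) (from (ω⁻¹-cutOut w a b) ∘ s≤s⁻¹)

-- Cutting lines with natural coefficients

-- The line L_{C/A, C/B} with denominators cleared; r > s becomes A < B.
IntegerCut : ℕ → ℕ → ℕ → List ℕ → Set
IntegerCut A B C τ = CutOutBy τ (λ a b → suc a * A + suc b * B ≤ C)

ι : ℕ → ℚᵘ
ι a = mkℚᵘ (ℤ.+ a) 0

toℚᵘ-line : ∀ {r s R S} a b → toℚᵘ r ≃ R → toℚᵘ s ≃ S →
  (toℚ a ℚ.* s ℚ.+ toℚ b ℚ.* r ℚ.≤ r ℚ.* s) ⇔ (ι a ℚᵘ.* S ℚᵘ.+ ι b ℚᵘ.* R ℚᵘ.≤ R ℚᵘ.* S)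
toℚᵘ-line {r} {s} {R} {S} a b r≃R s≃S = mk⇔
  (λ le → ℚᵘ.≤-respʳ-≃ rhs (ℚᵘ.≤-respˡ-≃ lhs (ℚ.toℚᵘ-mono-≤ le)))
  (λ le → ℚ.toℚᵘ-cancel-≤ (ℚᵘ.≤-respʳ-≃ (ℚᵘ.≃-sym rhs) (ℚᵘ.≤-respˡ-≃ (ℚᵘ.≃-sym lhs) le)))
  where
  lhs : toℚᵘ (toℚ a ℚ.* s ℚ.+ toℚ b ℚ.* r) ≃ ι a ℚᵘ.* S ℚᵘ.+ ι b ℚᵘ.* R
  lhs = ℚᵘ.≃-trans (ℚ.toℚᵘ-homo-+ (toℚ a ℚ.* s) (toℚ b ℚ.* r))
          (ℚᵘ.+-cong (ℚᵘ.≃-trans (ℚ.toℚᵘ-homo-* (toℚ a) s) (ℚᵘ.*-cong (ℚ.toℚᵘ-fromℚᵘ (ι a)) s≃S))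
                     (ℚᵘ.≃-trans (ℚ.toℚᵘ-homo-* (toℚ b) r) (ℚᵘ.*-cong (ℚ.toℚᵘ-fromℚᵘ (ι b)) r≃R)))
  rhs : toℚᵘ (r ℚ.* s) ≃ R ℚᵘ.* S
  rhs = ℚᵘ.≃-trans (ℚ.toℚᵘ-homo-* r s) (ℚᵘ.*-cong r≃R s≃S)

≤ᵘ⇔ : ∀ {p q x y} → ↥ p ≡ ℤ.+ x → ↥ q ≡ ℤ.+ y → p ℚᵘ.≤ q ⇔ x * ↧ₙ q ≤ y * ↧ₙ p
≤ᵘ⇔ {p} {q} {x} {y} p≡x q≡y = mk⇔
  (λ { (*≤* le) → ℤ.drop‿+≤+ (subst₂ ℤ._≤_ (cross x (↧ₙ q) p≡x) (cross y (↧ₙ p) q≡y) le) })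
  (λ le → *≤* (subst₂ ℤ._≤_ (sym (cross x (↧ₙ q) p≡x)) (sym (cross y (↧ₙ p) q≡y)) (+≤+ le)))
  where
  cross : ∀ {i} x n → i ≡ ℤ.+ x → i ℤ.* ℤ.+ n ≡ ℤ.+ (x * n)
  cross x n i≡x = trans (cong (ℤ._* ℤ.+ n) i≡x) (sym (ℤ.pos-* x n))

pos-*-* : ∀ x y z → (ℤ.+ x ℤ.* ℤ.+ y) ℤ.* ℤ.+ z ≡ ℤ.+ (x * y * z)
pos-*-* x y z = trans (cong (ℤ._* ℤ.+ z) (sym (ℤ.pos-* x y))) (sym (ℤ.pos-* (x * y) z))

ℚᵘ-line : ∀ a b n₁ d₁ n₂ d₂ →
  (ι a ℚᵘ.* mkℚᵘ (ℤ.+ n₂) d₂ ℚᵘ.+ ι b ℚᵘ.* mkℚᵘ (ℤ.+ n₁) d₁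
     ℚᵘ.≤ mkℚᵘ (ℤ.+ n₁) d₁ ℚᵘ.* mkℚᵘ (ℤ.+ n₂) d₂)
  ⇔ (a * (n₂ * suc d₁) + b * (n₁ * suc d₂) ≤ n₁ * n₂)
ℚᵘ-line a b n₁ d₁ n₂ d₂ = ⇔-trans (≤ᵘ⇔ lhs (sym (ℤ.pos-* n₁ n₂))) (mk⇔
  (λ le → *-cancelʳ-≤ _ _ (suc d₁ * suc d₂) (subst₂ _≤_ (e₁ a b n₁ d₁ n₂ d₂) (e₂ n₁ n₂ d₁ d₂) le))
  (λ le → subst₂ _≤_ (sym (e₁ a b n₁ d₁ n₂ d₂)) (sym (e₂ n₁ n₂ d₁ d₂)) (*-monoˡ-≤ (suc d₁ * suc d₂) le)))
  where
  R S : ℚᵘ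
  R = mkℚᵘ (ℤ.+ n₁) d₁
  S = mkℚᵘ (ℤ.+ n₂) d₂
  lhs : ↥ (ι a ℚᵘ.* S ℚᵘ.+ ι b ℚᵘ.* R) ≡ ℤ.+ (a * n₂ * (1 * suc d₁) + b * n₁ * (1 * suc d₂))
  lhs = trans (cong₂ ℤ._+_ (pos-*-* a n₂ _) (pos-*-* b n₁ _))
              (sym (ℤ.pos-+ (a * n₂ * (1 * suc d₁)) (b * n₁ * (1 * suc d₂))))
  e₁ : ∀ a b n₁ d₁ n₂ d₂ → (a * n₂ * (1 * suc d₁) + b * n₁ * (1 * suc d₂)) * (suc d₁ * suc d₂)
                         ≡ (a * (n₂ * suc d₁) + b * (n₁ * suc d₂)) * (suc d₁ * suc d₂)
  e₁ = solve-∀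
  e₂ : ∀ n₁ n₂ d₁ d₂ → n₁ * n₂ * ((1 * suc d₂) * (1 * suc d₁)) ≡ n₁ * n₂ * (suc d₁ * suc d₂)
  e₂ = solve-∀

cuttingLine⇔ : ∀ {r s n₁ d₁ n₂ d₂} → toℚᵘ r ≃ mkℚᵘ (ℤ.+ n₁) d₁ → toℚᵘ s ≃ mkℚᵘ (ℤ.+ n₂) d₂ →
  ∀ a b → (toℚ a ℚ.* s ℚ.+ toℚ b ℚ.* r ℚ.≤ r ℚ.* s) ⇔ (a * (n₂ * suc d₁) + b * (n₁ * suc d₂) ≤ n₁ * n₂)
cuttingLine⇔ {n₁ = n₁} {d₁} {n₂} {d₂} r≃ s≃ a b =
  ⇔-trans (toℚᵘ-line a b r≃ s≃) (ℚᵘ-line a b n₁ d₁ n₂ d₂)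

wide⇒integerCut : ∀ {τ} → Wide τ → ∃[ A ] ∃[ B ] ∃[ C ] A < B × IntegerCut A B C τ
wide⇒integerCut {τ} (mkℚ +[1+ x₁ ] d₁ _ , mkℚ +[1+ x₂ ] d₂ _ , _ , ℚ.*<* s<r , cut) =
  suc x₂ * suc d₁ , suc x₁ * suc d₂ , suc x₁ * suc x₂ , ℤ.drop‿+<+ s<r ,
  λ a b → ⇔-trans (⇔-sym (inDiagram⇔ τ a b)) (⇔-trans (cut (suc a) (suc b) (s≤s z≤n) (s≤s z≤n))
                                                      (cuttingLine⇔ ℚᵘ.≃-refl ℚᵘ.≃-refl (suc a) (suc b)))
wide⇒integerCut (mkℚ (ℤ.+ 0) _ _ , mkℚ +[1+ _ ] _ _ , _ , ℚ.*<* (+<+ ()) , _)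
wide⇒integerCut (mkℚ -[1+ _ ] _ _ , mkℚ +[1+ _ ] _ _ , _ , ℚ.*<* () , _)
wide⇒integerCut (_ , mkℚ (ℤ.+ 0) _ _ , ℚ.*<* (+<+ ()) , _)
wide⇒integerCut (_ , mkℚ -[1+ _ ] _ _ , ℚ.*<* () , _)

integerCut⇒wide : ∀ {τ A B C} → 1 ≤ A → A < B → 1 ≤ C → IntegerCut A B C τ → Wide τ
integerCut⇒wide {τ} {suc A} {suc B} {suc C} _ A<B _ cut = fromℚᵘ R , fromℚᵘ S , 0<s , s<r , cutting
  where
  R S : ℚᵘ
  R = mkℚᵘ (ℤ.+ suc C) A
  S = mkℚᵘ (ℤ.+ suc C) B
  R≃ : toℚᵘ (fromℚᵘ R) ≃ R
  R≃ = ℚ.toℚᵘ-fromℚᵘ R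
  S≃ : toℚᵘ (fromℚᵘ S) ≃ S
  S≃ = ℚ.toℚᵘ-fromℚᵘ S
  0<s : 0ℚ ℚ.< fromℚᵘ S
  0<s = ℚ.toℚᵘ-cancel-< (ℚᵘ.<-respʳ-≃ (ℚᵘ.≃-sym S≃) (*<* (+<+ (s≤s z≤n))))
  s<r : fromℚᵘ S ℚ.< fromℚᵘ R
  s<r = ℚ.toℚᵘ-cancel-< (ℚᵘ.<-respʳ-≃ (ℚᵘ.≃-sym R≃) (ℚᵘ.<-respˡ-≃ (ℚᵘ.≃-sym S≃)
          (*<* (+<+ (*-monoʳ-< (suc C) A<B)))))
  scaled : ∀ a b → a * suc A + b * suc B ≤ suc C
                  ⇔ a * (suc C * suc A) + b * (suc C * suc B) ≤ suc C * suc C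
  scaled a b = mk⇔
    (λ le → subst (_≤ suc C * suc C) (sym (distrib a b (suc A) (suc B) (suc C))) (*-monoˡ-≤ (suc C) le))
    (λ le → *-cancelʳ-≤ _ _ (suc C) (subst (_≤ suc C * suc C) (distrib a b (suc A) (suc B) (suc C)) le))
    where distrib : ∀ a b A B C → a * (C * A) + b * (C * B) ≡ (a * A + b * B) * C
          distrib = solve-∀
  cutting : CuttingLine (fromℚᵘ R) (fromℚᵘ S) τ
  cutting (suc a) (suc b) _ _ = ⇔-trans (inDiagram⇔ τ a b) (⇔-trans (cut a b)
    (⇔-trans (scaled (suc a) (suc b)) (⇔-sym (cuttingLine⇔ R≃ S≃ (suc a) (suc b)))))

belowLine-trade : ∀ {A B C} → A ≤ B → ∀ a b →
  suc a * A + suc (suc b) * B ≤ C → suc (suc a) * A + suc b * B ≤ C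
belowLine-trade {A} {B} {C} A≤B a b onLine = begin
  suc (suc a) * A + suc b * B    ≡⟨ e₁ a b A B ⟩
  A + (suc a * A + suc b * B)    ≤⟨ +-monoˡ-≤ _ A≤B ⟩
  B + (suc a * A + suc b * B)    ≡⟨ e₂ a b A B ⟩
  suc a * A + suc (suc b) * B    ≤⟨ onLine ⟩
  C                              ∎
  where
  open ≤-Reasoning
  e₁ : ∀ a b A B → suc (suc a) * A + suc b * B ≡ A + (suc a * A + suc b * B)
  e₁ = solve-∀
  e₂ : ∀ a b A B → B + (suc a * A + suc b * B) ≡ suc a * A + suc (suc b) * B
  e₂ = solve-∀

wide-decreasing : ∀ {τ} → IsPartition τ → Wide τ → Linked _>_ τ
wide-decreasing {τ} (_ , pos) wide with A , B , C , A<B , cut ← wide⇒integerCut {τ} wide =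
  cutOut-decreasing (belowLine-trade (<⇒≤ A<B)) cut pos

ω⁻¹-ω-wide : ∀ {τ} → IsPartition τ → Wide τ → ω⁻¹ (ω τ) ≡ τ
ω⁻¹-ω-wide isP wide = ω⁻¹-ω (wide-decreasing isP wide) (proj₂ isP)

-- Mechanical words

height : List Bool → ℕ → ℕ → ℕ → ℕ → ℕ
height w A B n m = suc m * A + prefixOnes w n * B

-- For n + m = |w|: prefixOnes w n = ⌊(C − (m+1)A)/B⌋, i.e. w is a mechanical word of slope A/B.
Mechanical : List Bool → ℕ → ℕ → ℕ → Set
Mechanical w A B C = ∀ n m → n + m ≡ length w → height w A B n m ≤ C × C < height w A B n m + B

NarrowHeights : List Bool → ℕ → ℕ → Set
NarrowHeights w A B = ∀ n m n′ m′ → n + m ≡ length w → n′ + m′ ≡ length w →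
  height w A B n m < height w A B n′ m′ + B

HasSlope : List Bool → ℕ → ℕ → Set
HasSlope w A B = ∀ i h → i + h ≤ length w →
  factorOnes w i h * B < B + h * A × h * A < B + factorOnes w i h * B

height-shiftᵐ : ∀ w A B n h m → height w A B n (h + m) ≡ height w A B n m + h * A
height-shiftᵐ w A B n h m = shift h m A (prefixOnes w n * B)
  where shift : ∀ h m A X → suc (h + m) * A + X ≡ suc m * A + X + h * A
        shift = solve-∀

height-shiftⁿ : ∀ w A B n h m → height w A B (n + h) m ≡ height w A B n m + factorOnes w n h * B
height-shiftⁿ w A B n h m = begin
  suc m * A + prefixOnes w (n + h) * B
    ≡⟨ cong (λ p → suc m * A + p * B) (prefixOnes-+ w n h) ⟩
  suc m * A + (prefixOnes w n + factorOnes w n h) * B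
    ≡⟨ shift (suc m * A) (prefixOnes w n) (factorOnes w n h) B ⟩
  suc m * A + prefixOnes w n * B + factorOnes w n h * B  ∎
  where open ≡-Reasoning
        shift : ∀ X p c B → X + (p + c) * B ≡ X + p * B + c * B
        shift = solve-∀

x+[y+z]≡x+z+y : ∀ x y z → x + (y + z) ≡ x + z + y
x+[y+z]≡x+z+y = solve-∀

n+m≡n+h+m′⇒m≡h+m′ : ∀ n h m m′ {ℓ} → n + m ≡ ℓ → n + h + m′ ≡ ℓ → m ≡ h + m′
n+m≡n+h+m′⇒m≡h+m′ n h m m′ e e′ =
  +-cancelˡ-≡ n m (h + m′) (trans e (trans (sym e′) (+-assoc n h m′)))

i+h+m≡ℓ⇒i+h≤ℓ : ∀ i h m {ℓ} → i + h + m ≡ ℓ → i + h ≤ ℓ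
i+h+m≡ℓ⇒i+h≤ℓ i h m refl = m≤m+n (i + h) m

narrow⇒hasSlope : ∀ {w A B} → NarrowHeights w A B → HasSlope w A B
narrow⇒hasSlope {w} {A} {B} narrow i h i+h≤ℓ with m , e ← m≤n⇒∃[o]m+o≡n i+h≤ℓ =
  +-cancelˡ-< X _ _ lower , +-cancelˡ-< X _ _ upper
  where
  open ≤-Reasoning
  X c : ℕ
  X = height w A B i m
  c = factorOnes w i h
  e′ : i + (h + m) ≡ length w
  e′ = trans (sym (+-assoc i h m)) e
  lower : X + c * B < X + (B + h * A)
  lower = begin-strict
    X + c * B                   ≡⟨ height-shiftⁿ w A B i h m ⟨
    height w A B (i + h) m      <⟨ narrow (i + h) m i (h + m) e e′ ⟩
    height w A B i (h + m) + B  ≡⟨ cong (_+ B) (height-shiftᵐ w A B i h m) ⟩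
    X + h * A + B               ≡⟨ x+[y+z]≡x+z+y X B (h * A) ⟨
    X + (B + h * A)             ∎
  upper : X + h * A < X + (B + c * B)
  upper = begin-strict
    X + h * A                   ≡⟨ height-shiftᵐ w A B i h m ⟨
    height w A B i (h + m)      <⟨ narrow i (h + m) (i + h) m e′ e ⟩
    height w A B (i + h) m + B  ≡⟨ cong (_+ B) (height-shiftⁿ w A B i h m) ⟩
    X + c * B + B               ≡⟨ x+[y+z]≡x+z+y X B (c * B) ⟨
    X + (B + c * B)             ∎

hasSlope⇒narrow : ∀ {w A B} → HasSlope w A B → NarrowHeights w A B
hasSlope⇒narrow {w} {A} {B} slope n m n′ m′ e e′ with ≤-total n n′
... | inj₁ n≤n′ with h , refl ← m≤n⇒∃[o]m+o≡n n≤n′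
                with refl ← n+m≡n+h+m′⇒m≡h+m′ n h m m′ e e′ = begin-strict
  height w A B n (h + m′)      ≡⟨ height-shiftᵐ w A B n h m′ ⟩
  X + h * A                    <⟨ +-monoʳ-< X (proj₂ (slope n h (i+h+m≡ℓ⇒i+h≤ℓ n h m′ e′))) ⟩
  X + (B + c * B)              ≡⟨ x+[y+z]≡x+z+y X B (c * B) ⟩
  X + c * B + B                ≡⟨ cong (_+ B) (height-shiftⁿ w A B n h m′) ⟨
  height w A B (n + h) m′ + B  ∎
  where open ≤-Reasoning
        X c : ℕ
        X = height w A B n m′
        c = factorOnes w n h
... | inj₂ n′≤n with h , refl ← m≤n⇒∃[o]m+o≡n n′≤n
                with refl ← n+m≡n+h+m′⇒m≡h+m′ n′ h m′ m e′ e = begin-strict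
  height w A B (n′ + h) m      ≡⟨ height-shiftⁿ w A B n′ h m ⟩
  X + c * B                    <⟨ +-monoʳ-< X (proj₁ (slope n′ h (i+h+m≡ℓ⇒i+h≤ℓ n′ h m e))) ⟩
  X + (B + h * A)              ≡⟨ x+[y+z]≡x+z+y X B (h * A) ⟩
  X + h * A + B                ≡⟨ cong (_+ B) (height-shiftᵐ w A B n′ h m) ⟨
  height w A B n′ (h + m) + B  ∎
  where open ≤-Reasoning
        X c : ℕ
        X = height w A B n′ m
        c = factorOnes w n′ h

mechanical⇒narrow : ∀ {w A B C} → Mechanical w A B C → NarrowHeights w A B
mechanical⇒narrow mech n m n′ m′ e e′ = ≤-<-trans (proj₁ (mech n m e)) (proj₂ (mech n′ m′ e′))

maxHeight : List Bool → ℕ → ℕ → ℕ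
maxHeight w A B = max 0 (applyUpTo (λ n → height w A B n (length w ∸ n)) (suc (length w)))

narrow⇒mechanical : ∀ {w A B} → NarrowHeights w A B → Mechanical w A B (maxHeight w A B)
narrow⇒mechanical {w} {A} {B} narrow n m e = below , above
  where
  heightAt : ℕ → ℕ
  heightAt n = height w A B n (length w ∸ n)
  heightAt-n : heightAt n ≡ height w A B n m
  heightAt-n = cong (height w A B n) (trans (cong (_∸ n) (sym e)) (m+n∸m≡n n m))
  below : height w A B n m ≤ maxHeight w A B
  below = subst (_≤ maxHeight w A B) heightAt-n
    (All.lookup (xs≤max 0 _) (∈-applyUpTo⁺ heightAt (s≤s (≤-trans (m≤m+n n m) (≤-reflexive e)))))
  above : maxHeight w A B < height w A B n m + B
  above = max<v⁺ (≤-<-trans z≤n (narrow n m n m e e)) (All.applyUpTo⁺₁ heightAt (suc (length w))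
    (λ {n′} n′≤ℓ → narrow n′ (length w ∸ n′) n m (m+[n∸m]≡n (s≤s⁻¹ n′≤ℓ)) e))

x+p*B+B≡x+[1+p]*B : ∀ x p B → x + p * B + B ≡ x + suc p * B
x+p*B+B≡x+[1+p]*B = solve-∀

x+p*B+B≤x+[1+b]*B : ∀ x p b B → p ≤ b → x + p * B + B ≤ x + suc b * B
x+p*B+B≤x+[1+b]*B x p b B p≤b =
  ≤-trans (≤-reflexive (x+p*B+B≡x+[1+p]*B x p B)) (+-monoʳ-≤ x (*-monoˡ-≤ B (s≤s p≤b)))

mechanical⇒prefixLine : ∀ {w A B C} → Mechanical w A B C →
  ∀ a b → suc b ≤ prefixOnes w (length w ∸ a) ⇔ suc a * A + suc b * B ≤ C
mechanical⇒prefixLine {w} {A} {B} {C} mech a b with a ≤? length w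
... | no a≰ℓ rewrite m≤n⇒m∸n≡0 (<⇒≤ (≰⇒> a≰ℓ)) = mk⇔ (λ ()) λ onLine →
  contradiction (<-≤-trans (proj₂ (mech 0 (length w) refl)) (begin
    suc (length w) * A + 0 + B      ≤⟨ x+p*B+B≤x+[1+b]*B (suc (length w) * A) 0 b B z≤n ⟩
    suc (length w) * A + suc b * B  ≤⟨ +-monoˡ-≤ (suc b * B) (*-monoˡ-≤ A (<⇒≤ (s≤s (≰⇒> a≰ℓ)))) ⟩
    suc a * A + suc b * B           ≤⟨ onLine ⟩
    C                               ∎)) (<-irrefl refl)
  where open ≤-Reasoning
... | yes a≤ℓ = mk⇔
  (λ b<P → ≤-trans (+-monoʳ-≤ (suc a * A) (*-monoˡ-≤ B b<P)) (proj₁ bounds))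
  (λ onLine → ≮⇒≥ λ P<1+b → <-irrefl refl
    (<-≤-trans (proj₂ bounds) (≤-trans (x+p*B+B≤x+[1+b]*B (suc a * A) _ b B (s≤s⁻¹ P<1+b)) onLine)))
  where
  bounds : height w A B (length w ∸ a) a ≤ C × C < height w A B (length w ∸ a) a + B
  bounds = mech (length w ∸ a) a (m∸n+n≡m a≤ℓ)

prefixLine⇒mechanical : ∀ {w A B C} → firstBit w ≡ true → A ≤ B →
  (∀ a b → suc b ≤ prefixOnes w (length w ∸ a) ⇔ suc a * A + suc b * B ≤ C) →
  Mechanical w A B C
prefixLine⇒mechanical {true ∷ w} {A} {B} {C} refl A≤B line n m e = below , above
  where
  open ≤-Reasoning
  ℓ P : ℕ
  ℓ = length w
  P = prefixOnes (true ∷ w) n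
  prefix-n : prefixOnes (true ∷ w) (suc ℓ ∸ m) ≡ P
  prefix-n = cong (prefixOnes (true ∷ w)) (trans (cong (_∸ m) (sym e)) (m+n∸n≡m n m))
  above : C < height (true ∷ w) A B n m + B
  above = ≰⇒> λ le → 1+n≰n (subst (suc P ≤_) prefix-n
    (from (line m P) (≤-trans (≤-reflexive (sym (x+p*B+B≡x+[1+p]*B (suc m * A) P B))) le)))
  below : height (true ∷ w) A B n m ≤ C
  below with prefixOnes (true ∷ w) n in P≡
  ... | suc p = to (line m p) (≤-reflexive (sym (trans prefix-n P≡)))
  ... | zero  = begin  -- the leading 1 puts the cell (ℓ+1, 1) under the line
    suc m * A + 0      ≡⟨ +-identityʳ (suc m * A) ⟩
    suc m * A          ≤⟨ *-monoˡ-≤ A (s≤s (≤-trans (m≤n+m m n) (≤-reflexive e))) ⟩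
    A + suc ℓ * A      ≤⟨ +-monoˡ-≤ (suc ℓ * A) A≤B ⟩
    B + suc ℓ * A      ≡⟨ +-comm B (suc ℓ * A) ⟩
    suc ℓ * A + B      ≡⟨ cong (suc ℓ * A +_) (+-identityʳ B) ⟨
    suc ℓ * A + 1 * B  ≤⟨ to (line ℓ 0) (≤-reflexive (cong (prefixOnes (true ∷ w)) (sym (m+n∸n≡m 1 ℓ)))) ⟩
    C                  ∎

hasSlope⇒balanced : ∀ {w A B} → HasSlope w A B → Balanced w
hasSlope⇒balanced {w} {A} {B} slope h i j _ u v =
  atMostOneMore (slope i h u) (slope j h v) , atMostOneMore (slope j h v) (slope i h u)
  where
  atMostOneMore : ∀ {c₁ c₂} → c₁ * B < B + h * A × h * A < B + c₁ * B →
                  c₂ * B < B + h * A × h * A < B + c₂ * B → c₁ ≤ suc c₂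
  atMostOneMore {c₁} {c₂} (below , _) (_ , above) =
    s≤s⁻¹ (*-cancelʳ-< B c₁ (suc (suc c₂)) (<-trans below (+-monoʳ-< B above)))

-- Balanced words have a slope

m<[1+m/n]*n : ∀ m n .{{_ : NonZero n}} → m < suc (m / n) * n
m<[1+m/n]*n m n = begin-strict
  m                  ≡⟨ m≡m%n+[m/n]*n m n ⟩
  m % n + m / n * n  <⟨ +-monoˡ-< (m / n * n) (m%n<n m n) ⟩
  n + m / n * n      ∎
  where open ≤-Reasoning

n≤n*n : ∀ n → n ≤ n * n
n≤n*n zero    = z≤n
n≤n*n (suc n) = m≤m*n (suc n) (suc n)

-- Rounding x·B/(1+d) down loses less than 1/B, and B > L² is finer than the gap between x/(1+d)
-- and a larger fraction y/q when 1 + d, q ≤ L.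
roundedSlope-below : ∀ L x d y q → suc d ≤ L → q ≤ L → x * q < y * suc d →
                     suc (x * suc (L * L) / suc d) * q < y * suc (L * L)
roundedSlope-below L x d y q d<L q≤L xq<yd = *-cancelˡ-< (suc d) _ _ (begin-strict
  suc d * (suc ⌊xB/d⌋ * q)        ≡⟨ e₁ (suc d) ⌊xB/d⌋ q ⟩
  ⌊xB/d⌋ * suc d * q + suc d * q  ≤⟨ +-monoˡ-≤ (suc d * q) (*-monoˡ-≤ q (m/n*n≤m (x * B) (suc d))) ⟩
  x * B * q + suc d * q           <⟨ +-monoʳ-< (x * B * q) (s≤s (*-mono-≤ d<L q≤L)) ⟩
  x * B * q + B                   ≡⟨ e₂ x B q ⟩
  suc (x * q) * B                 ≤⟨ *-monoˡ-≤ B xq<yd ⟩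
  y * suc d * B                   ≡⟨ e₃ y (suc d) B ⟩
  suc d * (y * B)                 ∎)
  where
  open ≤-Reasoning
  B ⌊xB/d⌋ : ℕ
  B = suc (L * L)
  ⌊xB/d⌋ = x * B / suc d
  e₁ : ∀ D v q → D * (suc v * q) ≡ v * D * q + D * q
  e₁ = solve-∀
  e₂ : ∀ x B q → x * B * q + B ≡ suc (x * q) * B
  e₂ = solve-∀
  e₃ : ∀ y D B → y * D * B ≡ D * (y * B)
  e₃ = solve-∀

-- A pair (x , d) stands for the fraction x/(1+d).
separatingSlope : ∀ L (lows : List (ℕ × ℕ)) → All (λ (_ , d) → suc d ≤ L) lows →
  ∃[ A ] ∃[ B ] 1 ≤ A
    × (∀ {x d} → (x , d) ∈ lows → x * B < A * suc d)
    × (∀ y q → 1 ≤ y → q ≤ L → All (λ (x , d) → x * q < y * suc d) lows → A * q < y * B)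
separatingSlope L lows short = A , B , s≤s z≤n , below , above
  where
  B : ℕ
  B = suc (L * L)
  ⌊_⌋ : ℕ × ℕ → ℕ
  ⌊ x , d ⌋ = x * B / suc d
  A : ℕ
  A = suc (max 0 (map ⌊_⌋ lows))
  below : ∀ {x d} → (x , d) ∈ lows → x * B < A * suc d
  below {x} {d} x/d∈lows = <-≤-trans (m<[1+m/n]*n (x * B) (suc d))
    (*-monoˡ-≤ (suc d) (s≤s (All.lookup (xs≤max 0 _) (∈-map⁺ ⌊_⌋ x/d∈lows))))
  above : ∀ y q → 1 ≤ y → q ≤ L → All (λ (x , d) → x * q < y * suc d) lows → A * q < y * B
  above y q y>0 q≤L under = argmax-all (λ v → v) {P = λ v → suc v * q < y * B} q<yB
    (All.map⁺ (All.zipWith (λ { {x , d} (d<L , xq<yd) → roundedSlope-below L x d y q d<L q≤L xq<yd })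
      (short , under)))
    where
    q<yB : 1 * q < y * B
    q<yB = begin-strict
      1 * q  ≡⟨ *-identityˡ q ⟩
      q      ≤⟨ q≤L ⟩
      L      ≤⟨ n≤n*n L ⟩
      L * L  <⟨ n<1+n (L * L) ⟩
      B      ≡⟨ *-identityˡ B ⟨
      1 * B  ≤⟨ *-monoˡ-≤ B y>0 ⟩
      y * B  ∎
      where open ≤-Reasoning

balanced⇒≤1+ : ∀ {w} → Balanced w → ∀ i j h → i + h ≤ length w → j + h ≤ length w →
               factorOnes w i h ≤ suc (factorOnes w j h)
balanced⇒≤1+ bal i j h u v = proj₁ (bal h i j (≤-trans (m≤n+m h i) u) u v)

slope-split-right : ∀ {c c₁ c₂ P r} → c ≤ suc c₁ → c * r < suc c₂ * P + r →
                    c * (P + r) < suc (c₁ + c₂) * P + (P + r)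
slope-split-right {c} {c₁} {c₂} {P} {r} c≤ ih = begin-strict
  c * (P + r)                    ≡⟨ *-distribˡ-+ c P r ⟩
  c * P + c * r                  ≤⟨ +-monoˡ-≤ (c * r) (*-monoˡ-≤ P c≤) ⟩
  suc c₁ * P + c * r             <⟨ +-monoʳ-< (suc c₁ * P) ih ⟩
  suc c₁ * P + (suc c₂ * P + r)  ≡⟨ regroup c₁ c₂ P r ⟩
  suc (c₁ + c₂) * P + (P + r)    ∎
  where
  open ≤-Reasoning
  regroup : ∀ c₁ c₂ P r → suc c₁ * P + (suc c₂ * P + r) ≡ suc (c₁ + c₂) * P + (P + r)
  regroup = solve-∀

slope-split-left : ∀ {c c₁ c₂ Q r} → c₁ ≤ suc c → c₂ * Q < suc c * r + Q →
                   (c₁ + c₂) * Q < suc c * (Q + r) + Q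
slope-split-left {c} {c₁} {c₂} {Q} {r} c₁≤ ih = begin-strict
  (c₁ + c₂) * Q                ≡⟨ *-distribʳ-+ Q c₁ c₂ ⟩
  c₁ * Q + c₂ * Q              ≤⟨ +-monoˡ-≤ (c₂ * Q) (*-monoˡ-≤ Q c₁≤) ⟩
  suc c * Q + c₂ * Q           <⟨ +-monoʳ-< (suc c * Q) ih ⟩
  suc c * Q + (suc c * r + Q)  ≡⟨ regroup c Q r ⟩
  suc c * (Q + r) + Q          ∎
  where
  open ≤-Reasoning
  regroup : ∀ c Q r → suc c * Q + (suc c * r + Q) ≡ suc c * (Q + r) + Q
  regroup = solve-∀

-- (ones u − 1)/|u| < (ones v + 1)/|v|: the longer factor is cut at the length of the shorter one.
balanced-slopes : ∀ {w} → Balanced w → ∀ i j P Q → Acc _<_ (P + Q) → 1 ≤ P → 1 ≤ Q →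
  i + P ≤ length w → j + Q ≤ length w → factorOnes w i P * Q < suc (factorOnes w j Q) * P + Q
balanced-slopes {w} bal i j P Q (acc rec) P>0 Q>0 u v with compare P Q
... | equal _ = ≤-<-trans (*-monoˡ-≤ Q (balanced⇒≤1+ bal i j P u v)) (m<m+n _ Q>0)
... | less _ k = subst₂ (λ c R → factorOnes w i P * R < suc c * P + R) (sym split) (+-suc P k)
  (slope-split-right (balanced⇒≤1+ bal i j P u (≤-trans (m≤m+n (j + P) (suc k)) v′))
    (balanced-slopes bal i (j + P) P (suc k) (rec (+-monoʳ-< P (s≤s (m<n+m k P>0))))
      P>0 (s≤s z≤n) u v′))
  where
  v′ : j + P + suc k ≤ length w
  v′ = ≤-trans (≤-reflexive (trans (+-assoc j P (suc k)) (cong (j +_) (+-suc P k)))) v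
  split : factorOnes w j (suc (P + k)) ≡ factorOnes w j P + factorOnes w (j + P) (suc k)
  split = trans (cong (factorOnes w j) (sym (+-suc P k))) (factorOnes-+ w j P (suc k))
... | greater _ k = subst₂ (λ c R → c * Q < suc (factorOnes w j Q) * R + Q) (sym split) (+-suc Q k)
  (slope-split-left (balanced⇒≤1+ bal i j Q (≤-trans (m≤m+n (i + Q) (suc k)) u′) v)
    (balanced-slopes bal (i + Q) j (suc k) Q (rec (+-monoˡ-< Q (s≤s (m<n+m k Q>0))))
      (s≤s z≤n) Q>0 u′ v))
  where
  u′ : i + Q + suc k ≤ length w
  u′ = ≤-trans (≤-reflexive (trans (+-assoc i Q (suc k)) (cong (i +_) (+-suc Q k)))) u
  split : factorOnes w i (suc (Q + k)) ≡ factorOnes w i Q + factorOnes w (i + Q) (suc k)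
  split = trans (cong (factorOnes w i) (sym (+-suc Q k))) (factorOnes-+ w i Q (suc k))

-- (i , d) is the factor of length 1 + d starting at position i.
Window : ℕ → ℕ × ℕ → Set
Window ℓ (i , d) = i + suc d ≤ ℓ

window? : ∀ ℓ → Decidable (Window ℓ)
window? ℓ (i , d) = i + suc d ≤? ℓ

windows : ℕ → List (ℕ × ℕ)
windows ℓ = filter (window? ℓ) (cartesianProduct (upTo ℓ) (upTo ℓ))

∈-windows : ∀ {ℓ i d} → Window ℓ (i , d) → (i , d) ∈ windows ℓ
∈-windows {ℓ} {i} {d} i+d<ℓ = ∈-filter⁺ (window? ℓ) (∈-cartesianProduct⁺ (∈-upTo⁺ i<ℓ) (∈-upTo⁺ d<ℓ)) i+d<ℓ
  where
  i<ℓ : i < ℓ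
  i<ℓ = ≤-trans (s≤s (m≤m+n i d)) (≤-trans (≤-reflexive (sym (+-suc i d))) i+d<ℓ)
  d<ℓ : d < ℓ
  d<ℓ = ≤-trans (m≤n+m (suc d) i) i+d<ℓ

windows-valid : ∀ ℓ → All (Window ℓ) (windows ℓ)
windows-valid ℓ = All.all-filter (window? ℓ) (cartesianProduct (upTo ℓ) (upTo ℓ))

c*Q<R+Q⇒[c∸1]*Q<R : ∀ c Q R → 1 ≤ R → c * Q < R + Q → (c ∸ 1) * Q < R
c*Q<R+Q⇒[c∸1]*Q<R zero    Q R R>0 _  = R>0
c*Q<R+Q⇒[c∸1]*Q<R (suc c) Q R _   lt =
  +-cancelʳ-< Q (c * Q) R (subst (_< R + Q) (+-comm Q (c * Q)) lt)

c*B≤B+[c∸1]*B : ∀ c B → c * B ≤ B + (c ∸ 1) * B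
c*B≤B+[c∸1]*B zero    B = z≤n
c*B≤B+[c∸1]*B (suc c) B = ≤-refl

-- ones u ∸ 1 truncates at 0, which is harmless: 0 is a lower bound for the slope too.
lowerBound : List Bool → ℕ × ℕ → ℕ × ℕ
lowerBound w (i , d) = factorOnes w i (suc d) ∸ 1 , d

lowerBounds : List Bool → List (ℕ × ℕ)
lowerBounds w = map (lowerBound w) (windows (length w))

lowerBounds-short : ∀ w → All (λ (_ , d) → suc d ≤ length w) (lowerBounds w)
lowerBounds-short w =
  All.map⁺ (All.map (λ {(i , d)} → ≤-trans (m≤n+m (suc d) i)) (windows-valid (length w)))

lowerBounds-below : ∀ {w} → Balanced w → ∀ j Q → j + Q ≤ length w → 1 ≤ Q →
  All (λ (x , d) → x * Q < suc (factorOnes w j Q) * suc d) (lowerBounds w)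
lowerBounds-below {w} bal j Q v Q>0 = All.map⁺ (All.map (λ {(i , d)} u →
  c*Q<R+Q⇒[c∸1]*Q<R (factorOnes w i (suc d)) Q _ (s≤s z≤n)
    (balanced-slopes bal i j (suc d) Q (<-wellFounded _) (s≤s z≤n) Q>0 u v)) (windows-valid (length w)))

lowerBounds-<1 : ∀ w → All (λ (x , d) → x * 1 < 1 * suc d) (lowerBounds w)
lowerBounds-<1 w = All.map⁺ (All.map (λ {(i , d)} _ →
  subst₂ _<_ (sym (*-identityʳ _)) (sym (*-identityˡ (suc d))) (s≤s (∸-monoˡ-≤ 1 (factorOnes-≤ w i (suc d)))))
  (windows-valid (length w)))

balanced⇒hasSlope : ∀ {w} → Balanced w → 1 ≤ length w → ∃[ A ] ∃[ B ] 1 ≤ A × A < B × HasSlope w A B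
balanced⇒hasSlope {w} bal ℓ>0
  with A , B , A>0 , below , above ← separatingSlope (length w) (lowerBounds w) (lowerBounds-short w) =
  A , B , A>0 , A<B , slope
  where
  A<B : A < B
  A<B = subst₂ _<_ (*-identityʳ A) (*-identityˡ B) (above 1 1 ≤-refl ℓ>0 (lowerBounds-<1 w))
  B>0 : 0 < B + 0
  B>0 = ≤-trans (≤-trans (s≤s z≤n) A<B) (m≤m+n B 0)
  slope : HasSlope w A B
  slope i zero    _ = B>0 , B>0
  slope i (suc d) v = lower , upper
    where
    c : ℕ
    c = factorOnes w i (suc d)
    lower : c * B < B + suc d * A
    lower = begin-strict
      c * B            ≤⟨ c*B≤B+[c∸1]*B c B ⟩
      B + (c ∸ 1) * B  <⟨ +-monoʳ-< B (below (∈-map⁺ (lowerBound w) (∈-windows v))) ⟩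
      B + A * suc d    ≡⟨ cong (B +_) (*-comm A (suc d)) ⟩
      B + suc d * A    ∎
      where open ≤-Reasoning
    upper : suc d * A < B + c * B
    upper = subst (_< B + c * B) (*-comm A (suc d)) (above (suc c) (suc d) (s≤s z≤n)
      (≤-trans (m≤n+m (suc d) i) v) (lowerBounds-below bal i (suc d) v (s≤s z≤n)))

firstBit-ω : ∀ t τ → firstBit (ω (t ∷ τ)) ≡ true
firstBit-ω t []      = refl
firstBit-ω t (_ ∷ _) = refl

ω-wide-balanced : ∀ {t τ} → IsPartition (t ∷ τ) → Wide (t ∷ τ) → Balanced (ω (t ∷ τ))
ω-wide-balanced {t} {τ} isP wide with A , B , C , A<B , cut ← wide⇒integerCut {t ∷ τ} wide =
  hasSlope⇒balanced (narrow⇒hasSlope (mechanical⇒narrow mech))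
  where
  w : List Bool
  w = ω (t ∷ τ)
  cut′ : IntegerCut A B C (ω⁻¹ w)
  cut′ = subst (IntegerCut A B C) (sym (ω⁻¹-ω-wide isP wide)) cut
  mech : Mechanical w A B C
  mech = prefixLine⇒mechanical (firstBit-ω t τ) (<⇒≤ A<B)
           λ a b → ⇔-trans (⇔-sym (ω⁻¹-cutOut w a b)) (cut′ a b)

ω⁻¹-balanced-wide : ∀ {w} → Balanced (true ∷ w) → Wide (ω⁻¹ (true ∷ w))
ω⁻¹-balanced-wide {w} bal = wideFrom (balanced⇒hasSlope bal (s≤s z≤n))
  where
  wideFrom : ∃[ A ] ∃[ B ] 1 ≤ A × A < B × HasSlope (true ∷ w) A B → Wide (ω⁻¹ (true ∷ w))
  wideFrom (A , B , A>0 , A<B , slope) = integerCut⇒wide A>0 A<B C>0 cut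
    where
    C : ℕ
    C = maxHeight (true ∷ w) A B
    mech : Mechanical (true ∷ w) A B C
    mech = narrow⇒mechanical (hasSlope⇒narrow slope)
    C>0 : 1 ≤ C
    C>0 = ≤-trans A>0 (≤-trans (≤-trans (m≤m+n A _) (m≤m+n _ _)) (proj₁ (mech 0 (suc (length w)) refl)))
    cut : IntegerCut A B C (ω⁻¹ (true ∷ w))
    cut a b = ⇔-trans (ω⁻¹-cutOut (true ∷ w) a b) (mechanical⇒prefixLine mech a b)

ω-balancedWord : ∀ {k ℓ τ} → 1 ≤ k → WideTriangular k ℓ τ → BalancedWord k ℓ (ω τ)
ω-balancedWord {τ = t ∷ τ} _ (isP , wide , refl , refl) =
  length-ω (wide-decreasing isP wide) (proj₂ isP) , ω-wide-balanced isP wide ,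
  trans (sym (length-ω⁻¹ (ω (t ∷ τ)))) (cong length (ω⁻¹-ω-wide isP wide)) , firstBit-ω t τ

ω-injective : ∀ {k ℓ τ τ′} → WideTriangular k ℓ τ → WideTriangular k ℓ τ′ → ω τ ≡ ω τ′ → τ ≡ τ′
ω-injective (isP , wide , _) (isP′ , wide′ , _) ωτ≡ωτ′ =
  trans (sym (ω⁻¹-ω-wide isP wide)) (trans (cong ω⁻¹ ωτ≡ωτ′) (ω⁻¹-ω-wide isP′ wide′))

ω-surjective : ∀ {k ℓ w} → BalancedWord k ℓ w → ∃[ τ ] WideTriangular k ℓ τ × ω τ ≡ w
ω-surjective {w = true ∷ w} (refl , bal , refl , _) =
  ω⁻¹ (true ∷ w) ,
  (ω⁻¹-isPartition (true ∷ w) , ω⁻¹-balanced-wide bal , length-ω⁻¹ (true ∷ w) , refl) ,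
  ω-ω⁻¹ w

-- The hypothesis 1 ≤ ℓ is implied by 1 ≤ k.
proposition5p6 : (k ℓ : ℕ) → 1 ≤ k → 1 ≤ ℓ →
    ((τ : List ℕ) → WideTriangular k ℓ τ → BalancedWord k ℓ (ω τ))
    × ((τ τ′ : List ℕ) → WideTriangular k ℓ τ → WideTriangular k ℓ τ′ → ω τ ≡ ω τ′ → τ ≡ τ′)
    × ((w : List Bool) → BalancedWord k ℓ w → ∃[ τ ] (WideTriangular k ℓ τ × ω τ ≡ w))
proposition5p6 k ℓ k≥1 _ = (λ _ → ω-balancedWord k≥1) , (λ _ _ → ω-injective) , (λ _ → ω-surjective)
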